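{- Let $d\ge5$ and let $G\le C_2\wr_{[d]}A_d$ be a subgroup such that the natural projection $\pi\colon G\to A_d$ is surjective. Then $\pi$ splits, i.e., there is a homomorphism $s\colon A_d\to G$ with $\pi\circ s=\mathrm{id}_{A_d}$.
   Context: $[d]=\{1,\dots,d\}$ and $C_2\wr_{[d]}A_d=C_2^{[d]}\rtimes A_d$, where $A_d$ permutes the coordinates of $C_2^{[d]}$ via its natural action on $[d]$; $\pi$ is the restriction to $G$ of the quotient map onto $A_d$. -}

module Defs where

open import Data.Nat using (ℕ; _<ᵇ_; _%_)
open import Data.Bool using (Bool; false; if_then_else_; _∧_; _xor_)
open import Data.Fin using (Fin; toℕ)
open import Data.List using (List; map; allFin)
open import Data.Nat.ListAction using (sum)
open import Data.Product using (_×_; _,_; proj₁; proj₂)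
open import Data.Fin.Permutation using (Permutation′; _⟨$⟩ʳ_; _⟨$⟩ˡ_; _∘ₚ_; flip)
  renaming (id to idₚ)
open import Relation.Binary.PropositionalEquality using (_≡_)

Perm : ℕ → Set
Perm d = Permutation′ d

_≈ₚ_ : ∀ {d} → Perm d → Perm d → Set
σ ≈ₚ τ = ∀ i → σ ⟨$⟩ʳ i ≡ τ ⟨$⟩ʳ i

-- usual composition: (σ ∘ τ)(i) = σ (τ i)
_∘'_ : ∀ {d} → Perm d → Perm d → Perm d
σ ∘' τ = τ ∘ₚ σ

inversions : ∀ {d} → Perm d → ℕ
inversions {d} σ = sum (map (λ i → sum (map (λ j →
  if (toℕ i <ᵇ toℕ j) ∧ (toℕ (σ ⟨$⟩ʳ j) <ᵇ toℕ (σ ⟨$⟩ʳ i)) then 1 else 0)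
  (allFin d))) (allFin d))

IsEven : ∀ {d} → Perm d → Set
IsEven σ = inversions σ % 2 ≡ 0

-- C₂^[d] as Fin d → Bool (addition = xor), A_d acting by (σ·w)(i) = w(σ⁻¹ i)
Vect : ℕ → Set
Vect d = Fin d → Bool

act : ∀ {d} → Perm d → Vect d → Vect d
act σ w i = w (σ ⟨$⟩ˡ i)

-- elements of the ambient semidirect product C₂^[d] ⋊ Sym(d);
-- the wreath product C₂ ≀ A_d consists of those with even permutation part.
W : ℕ → Set
W d = Vect d × Perm d

_≈W_ : ∀ {d} → W d → W d → Set
(v , σ) ≈W (w , τ) = (∀ i → v i ≡ w i) × σ ≈ₚ τ

_·_ : ∀ {d} → W d → W d → W d
(v , σ) · (w , τ) = (λ i → v i xor act σ w i) , (σ ∘' τ)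

e : ∀ {d} → W d
e = (λ _ → false) , idₚ

_⁻¹ : ∀ {d} → W d → W d
(v , σ) ⁻¹ = act (flip σ) v , flip σ

proj : ∀ {d} → W d → Perm d
proj = proj₂

record IsSubgroup {d : ℕ} (G : W d → Set) : Set where
  field
    inWreath : ∀ x → G x → IsEven (proj x)
    resp     : ∀ x y → x ≈W y → G x → G y
    hasId    : G e
    closed·  : ∀ x y → G x → G y → G (x · y)
    closed⁻¹ : ∀ x → G x → G (x ⁻¹)

ProjSurjective : ∀ {d} → (W d → Set) → Set
ProjSurjective {d} G = ∀ (σ : Perm d) → IsEven σ →
  Data.Product.Σ (W d) (λ x → G x × proj x ≈ₚ σ)

-- π splits: a homomorphism s : A_d → G with π ∘ s = id
-- (s is a function on all permutations; only its values on A_d matter)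
Splits : ∀ {d} → (W d → Set) → Set
Splits {d} G = Data.Product.Σ (Perm d → W d) λ s →
  (∀ σ → IsEven σ → G (s σ)) ×
  (∀ σ τ → IsEven σ → IsEven τ → σ ≈ₚ τ → s σ ≈W s τ) ×
  (∀ σ τ → IsEven σ → IsEven τ → s (σ ∘' τ) ≈W (s σ · s τ)) ×
  (∀ σ → IsEven σ → proj (s σ) ≈ₚ σ)

-- Let K = {y | (y , id) ∈ G}, an A_d-invariant subspace of C₂^d, and write a′ = suc a, so that the
-- points are 0 and the a′.  For every v the map σ ↦ (v + σv , σ) is a homomorphism, so it suffices to
-- find v with (v + cv , c) ∈ G for the 3-cycles c = c_ab = (0 a′ b′).  These generate A_d: every
-- permutation is a word in the transpositions (0 a′), and since the parity of the inversion count is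
-- multiplicative, an even permutation is a word of even length.  If g ∈ G lifts c_ab then g⁴ lifts
-- c_ab too, and its translation part u_ab is an even vector supported on {0, a′, b′}.  Take v 0 = 0
-- and v a′ = u_ab₀ a′ for one fixed b₀ ≠ a.  The discrepancy u_ab + v + c_ab v is again even and
-- supported on {0, a′, b′}; it vanishes unless u_ab a′ depends on b or u_ab 0 ≠ u_ba b′.  Comparing
-- the two lifts of c_ab = c_cb ∘ c_ac, resp. of c_ab² = c_ba, turns either failure into an element of
-- K that is non-constant (d ≥ 5 leaves a point outside {0, a′, b′, c′}); then K contains every even
-- vector, and the discrepancy lies in K after all.

module Submission where

open import Defs
open import Data.Nat using (ℕ; zero; suc; _+_; _<_; _≤_; _<ᵇ_; _%_; s≤s; z≤n)
import Data.Nat.ListAction as ℕ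
open import Data.Bool using (Bool; true; false; not; _∧_; _xor_; if_then_else_)
open import Data.Bool.Properties
  using ( xor-∧-commutativeRing; xor-same; xor-comm; xor-assoc; xor-identityʳ; xor-inverseʳ
        ; xor-annihilates-not; not-involutive; not-distribˡ-xor
        ; ∧-zeroʳ; ∧-identityʳ; ∧-distribˡ-xor; ∧-distribʳ-xor)
  renaming (_≟_ to _≟ᵇ_)
open import Data.Fin using (Fin; zero; suc; toℕ)
open import Data.Fin.Properties using (_≟_; toℕ-injective; suc-injective; ¬∀⟶∃¬; any?; <⇒notInjective)
open import Data.List using (List; []; _∷_; [_]; _++_; map; allFin; tabulate)
open import Data.List.Properties using (map-tabulate)
open import Data.Product using (∃; _×_; _,_; proj₁; proj₂)
open import Data.Sum using (_⊎_; inj₁; inj₂; [_,_]′)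
open import Data.Fin.Permutation using (_⟨$⟩ʳ_; _⟨$⟩ˡ_; _∘ₚ_; flip; transpose; inverseˡ; inverseʳ)
  renaming (id to idₚ)
import Data.Fin.Permutation.Components as PC
open import Data.Fin.Permutation.Transposition.List using (TranspositionList; eval; decompose; eval-decompose)
open import Function using (_∘_; Inverse)
open import Relation.Binary.PropositionalEquality
  using (_≡_; _≢_; ≢-sym; refl; sym; trans; cong; cong₂; subst; module ≡-Reasoning)
open import Relation.Nullary using (¬_; Dec; yes; no; does; contradiction)
open import Relation.Nullary.Decidable using (dec-true; dec-false)
open import Algebra.Bundles using (CommutativeRing)
import Algebra.Properties.CommutativeMonoid.Sum as CommutativeMonoidSum
import Algebra.Properties.CommutativeSemigroup as CommutativeSemigroupProperties

open CommutativeMonoidSum (CommutativeRing.+-commutativeMonoid xor-∧-commutativeRing)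
  using (sum-syntax; sum-cong-≗; ∑-distrib-+; ∑-comm; sum-permute)

open CommutativeSemigroupProperties (CommutativeRing.+-commutativeSemigroup xor-∧-commutativeRing)
  using () renaming (interchange to xor-interchange)

xor-cancelˡ : ∀ x y → x xor (x xor y) ≡ y
xor-cancelˡ x y = trans (sym (xor-assoc x x y)) (cong (_xor y) (xor-same x))

xor-cancelʳ : ∀ x y → (x xor y) xor x ≡ y
xor-cancelʳ x y = trans (xor-comm (x xor y) x) (xor-cancelˡ x y)

≢⇒xor≡true : ∀ {x y} → x ≢ y → x xor y ≡ true
≢⇒xor≡true {false} {false} x≢y = contradiction refl x≢y
≢⇒xor≡true {false} {true}  _   = refl
≢⇒xor≡true {true}  {false} _   = refl
≢⇒xor≡true {true}  {true}  x≢y = contradiction refl x≢y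

xor-true-either : ∀ z {x y} → x xor y ≡ true → z xor x ≡ true ⊎ z xor y ≡ true
xor-true-either false {false} x≠y = inj₂ x≠y
xor-true-either false {true}  _   = inj₁ refl
xor-true-either true  {false} _   = inj₁ refl
xor-true-either true  {true}  x≠y = inj₂ x≠y

xor-telescope : ∀ x y z → x xor z ≡ (x xor y) xor (y xor z)
xor-telescope x y z = sym (trans (xor-assoc x y (y xor z)) (cong (x xor_) (xor-cancelˡ y z)))

xor≡false⇒≡ : ∀ {x y} → x xor y ≡ false → x ≡ y
xor≡false⇒≡ {false} {false} _ = refl
xor≡false⇒≡ {true}  {true}  _ = refl

∧-not≡∧-xor : ∀ x y → x ∧ not y ≡ x ∧ (y xor x)
∧-not≡∧-xor false _     = refl
∧-not≡∧-xor true  false = refl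
∧-not≡∧-xor true  true  = refl

-- Parity of permutations

odd : ℕ → Bool
odd zero    = false
odd (suc m) = not (odd m)

odd-+ : ∀ m n → odd (m + n) ≡ odd m xor odd n
odd-+ zero    n = refl
odd-+ (suc m) n = trans (cong not (odd-+ m n)) (not-distribˡ-xor (odd m) (odd n))

odd-sum-tabulate : ∀ {n} (h : Fin n → ℕ) → odd (ℕ.sum (tabulate h)) ≡ ∑[ i < n ] odd (h i)
odd-sum-tabulate {zero}  h = refl
odd-sum-tabulate {suc n} h =
  trans (odd-+ (h zero) _) (cong (odd (h zero) xor_) (odd-sum-tabulate (h ∘ suc)))

odd-sum-allFin : ∀ {n} (h : Fin n → ℕ) → odd (ℕ.sum (map h (allFin n))) ≡ ∑[ i < n ] odd (h i)
odd-sum-allFin h = trans (cong (odd ∘ ℕ.sum) (map-tabulate (λ i → i) h)) (odd-sum-tabulate h)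

odd-if : ∀ b → odd (if b then 1 else 0) ≡ b
odd-if false = refl
odd-if true  = refl

%2≡0⇒¬odd : ∀ m → m % 2 ≡ 0 → odd m ≡ false
%2≡0⇒¬odd zero          _ = refl
%2≡0⇒¬odd (suc zero)    ()
%2≡0⇒¬odd (suc (suc m)) m%2≡0 = trans (not-involutive (odd m)) (%2≡0⇒¬odd m m%2≡0)

¬odd⇒%2≡0 : ∀ m → odd m ≡ false → m % 2 ≡ 0
¬odd⇒%2≡0 zero          _ = refl
¬odd⇒%2≡0 (suc zero)    ()
¬odd⇒%2≡0 (suc (suc m)) ¬odd = ¬odd⇒%2≡0 m (trans (sym (not-involutive (odd m))) ¬odd)

<ᵇ-irrefl : ∀ m → (m <ᵇ m) ≡ false
<ᵇ-irrefl zero    = refl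
<ᵇ-irrefl (suc m) = <ᵇ-irrefl m

<ᵇ-flip : ∀ {m n} → m ≢ n → (n <ᵇ m) ≡ not (m <ᵇ n)
<ᵇ-flip {zero}  {zero}  m≢n = contradiction refl m≢n
<ᵇ-flip {zero}  {suc n} _   = refl
<ᵇ-flip {suc m} {zero}  _   = refl
<ᵇ-flip {suc m} {suc n} m≢n = <ᵇ-flip (m≢n ∘ cong suc)

<ᵇ-asym : ∀ m n → ((m <ᵇ n) ∧ (n <ᵇ m)) ≡ false
<ᵇ-asym zero    zero    = refl
<ᵇ-asym zero    (suc n) = refl
<ᵇ-asym (suc m) zero    = refl
<ᵇ-asym (suc m) (suc n) = <ᵇ-asym m n

lt : ∀ {n} → Fin n → Fin n → Bool
lt i j = toℕ i <ᵇ toℕ j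

lt-irrefl : ∀ {n} (i : Fin n) → lt i i ≡ false
lt-irrefl i = <ᵇ-irrefl (toℕ i)

lt-flip : ∀ {n} {i j : Fin n} → i ≢ j → lt j i ≡ not (lt i j)
lt-flip i≢j = <ᵇ-flip (i≢j ∘ toℕ-injective)

∑² : ∀ {n} → (Fin n → Fin n → Bool) → Bool
∑² {n} f = ∑[ i < n ] ∑[ j < n ] f i j

∑²-cong : ∀ {n} {f g : Fin n → Fin n → Bool} → (∀ i j → f i j ≡ g i j) → ∑² f ≡ ∑² g
∑²-cong f≗g = sum-cong-≗ (λ i → sum-cong-≗ (f≗g i))

∑²-xor : ∀ {n} (f g : Fin n → Fin n → Bool) → ∑² (λ i j → f i j xor g i j) ≡ ∑² f xor ∑² g
∑²-xor {n} f g = trans (sum-cong-≗ (λ i → ∑-distrib-+ (f i) (g i)))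
                       (∑-distrib-+ (λ i → ∑[ j < n ] f i j) (λ i → ∑[ j < n ] g i j))

∑²-permute : ∀ {n} (f : Fin n → Fin n → Bool) (ρ : Perm n) →
             ∑² f ≡ ∑² (λ i j → f (ρ ⟨$⟩ʳ i) (ρ ⟨$⟩ʳ j))
∑²-permute f ρ = trans (sum-permute _ ρ) (sum-cong-≗ (λ i → sum-permute (f (ρ ⟨$⟩ʳ i)) ρ))

-- f is the sum of its strict upper triangle and the transpose of that triangle.
∑²-symmetric : ∀ {n} (f : Fin n → Fin n → Bool) → (∀ i j → f i j ≡ f j i) → (∀ i → f i i ≡ false) →
               ∑² f ≡ false
∑²-symmetric {n} f f-sym f-diag = begin
  ∑² f                          ≡⟨ ∑²-cong halves ⟩
  ∑² (λ i j → g i j xor g j i)  ≡⟨ ∑²-xor g (λ i j → g j i) ⟩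
  ∑² g xor ∑² (λ i j → g j i)   ≡⟨ cong (∑² g xor_) (∑-comm g) ⟨
  ∑² g xor ∑² g                 ≡⟨ xor-same (∑² g) ⟩
  false                         ∎
  where
  open ≡-Reasoning
  g : Fin n → Fin n → Bool
  g i j = lt i j ∧ f i j
  halves : ∀ i j → f i j ≡ g i j xor g j i
  halves i j with i ≟ j
  ... | yes refl = trans (f-diag i) (sym (xor-same (g i i)))
  ... | no  i≢j  = sym (begin
    (lt i j ∧ f i j) xor (lt j i ∧ f j i)
      ≡⟨ cong₂ (λ l x → (lt i j ∧ f i j) xor (l ∧ x)) (lt-flip i≢j) (f-sym j i) ⟩
    (lt i j ∧ f i j) xor (not (lt i j) ∧ f i j)
      ≡⟨ ∧-distribʳ-xor (f i j) (lt i j) (not (lt i j)) ⟨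
    (lt i j xor not (lt i j)) ∧ f i j
      ≡⟨ cong (_∧ f i j) (xor-inverseʳ (lt i j)) ⟩
    f i j ∎)

flips : ∀ {n} → Perm n → Fin n → Fin n → Bool
flips σ i j = lt (σ ⟨$⟩ʳ i) (σ ⟨$⟩ʳ j) xor lt i j

σ-injective : ∀ {n} (σ : Perm n) {i j} → σ ⟨$⟩ʳ i ≡ σ ⟨$⟩ʳ j → i ≡ j
σ-injective σ eq = trans (sym (inverseˡ σ)) (trans (cong (σ ⟨$⟩ˡ_) eq) (inverseˡ σ))

flips-sym : ∀ {n} (σ : Perm n) i j → flips σ i j ≡ flips σ j i
flips-sym σ i j with i ≟ j
... | yes refl = refl
... | no  i≢j  = sym (trans (cong₂ _xor_ (lt-flip (i≢j ∘ σ-injective σ)) (lt-flip i≢j))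
                            (xor-annihilates-not (lt (σ ⟨$⟩ʳ i) (σ ⟨$⟩ʳ j)) (lt i j)))

flips-diag : ∀ {n} (σ : Perm n) i → flips σ i i ≡ false
flips-diag σ i = cong₂ _xor_ (lt-irrefl (σ ⟨$⟩ʳ i)) (lt-irrefl i)

flips-∘ : ∀ {n} (σ τ : Perm n) i j → flips (σ ∘' τ) i j ≡ flips σ (τ ⟨$⟩ʳ i) (τ ⟨$⟩ʳ j) xor flips τ i j
flips-∘ σ τ i j =
  xor-telescope (lt (σ ⟨$⟩ʳ (τ ⟨$⟩ʳ i)) (σ ⟨$⟩ʳ (τ ⟨$⟩ʳ j))) (lt (τ ⟨$⟩ʳ i) (τ ⟨$⟩ʳ j)) (lt i j)

-- Reindexing a symmetric summand by ρ only changes which of (i, j) and (j, i) is counted.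
∑²-relabel : ∀ {n} (ρ : Perm n) (f : Fin n → Fin n → Bool) → (∀ i j → f i j ≡ f j i) →
             ∑² (λ i j → lt (ρ ⟨$⟩ʳ i) (ρ ⟨$⟩ʳ j) ∧ f i j) ≡ ∑² (λ i j → lt i j ∧ f i j)
∑²-relabel ρ f f-sym = xor≡false⇒≡ (begin
  ∑² (λ i j → lt (ρ ⟨$⟩ʳ i) (ρ ⟨$⟩ʳ j) ∧ f i j) xor ∑² (λ i j → lt i j ∧ f i j)
    ≡⟨ ∑²-xor (λ i j → lt (ρ ⟨$⟩ʳ i) (ρ ⟨$⟩ʳ j) ∧ f i j) (λ i j → lt i j ∧ f i j) ⟨
  ∑² (λ i j → (lt (ρ ⟨$⟩ʳ i) (ρ ⟨$⟩ʳ j) ∧ f i j) xor (lt i j ∧ f i j))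
    ≡⟨ ∑²-cong (λ i j → ∧-distribʳ-xor (f i j) (lt (ρ ⟨$⟩ʳ i) (ρ ⟨$⟩ʳ j)) (lt i j)) ⟨
  ∑² (λ i j → flips ρ i j ∧ f i j)
    ≡⟨ ∑²-symmetric _ (λ i j → cong₂ _∧_ (flips-sym ρ i j) (f-sym i j))
                      (λ i → cong (_∧ f i i) (flips-diag ρ i)) ⟩
  false ∎)
  where open ≡-Reasoning

sign : ∀ {n} → Perm n → Bool
sign σ = odd (inversions σ)

sign≡∑²inversions : ∀ {n} (σ : Perm n) → sign σ ≡ ∑² (λ i j → lt i j ∧ lt (σ ⟨$⟩ʳ j) (σ ⟨$⟩ʳ i))
sign≡∑²inversions {n} σ = trans (odd-sum-allFin row)
  (sum-cong-≗ λ i → trans (odd-sum-allFin (entry i)) (sum-cong-≗ λ j → odd-if (inverted i j)))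
  where
  inverted : Fin n → Fin n → Bool
  inverted i j = lt i j ∧ lt (σ ⟨$⟩ʳ j) (σ ⟨$⟩ʳ i)
  entry : Fin n → Fin n → ℕ
  entry i j = if inverted i j then 1 else 0
  row : Fin n → ℕ
  row i = ℕ.sum (map (entry i) (allFin n))

sign≡∑²flips : ∀ {n} (σ : Perm n) → sign σ ≡ ∑² (λ i j → lt i j ∧ flips σ i j)
sign≡∑²flips σ = trans (sign≡∑²inversions σ) (∑²-cong inversion≡flip)
  where
  inversion≡flip : ∀ i j → lt i j ∧ lt (σ ⟨$⟩ʳ j) (σ ⟨$⟩ʳ i) ≡ lt i j ∧ flips σ i j
  inversion≡flip i j with i ≟ j
  ... | yes refl rewrite lt-irrefl i = refl
  ... | no  i≢j  = trans (cong (lt i j ∧_) (lt-flip (i≢j ∘ σ-injective σ)))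
                         (∧-not≡∧-xor (lt i j) (lt (σ ⟨$⟩ʳ i) (σ ⟨$⟩ʳ j)))

sign-∘ : ∀ {n} (σ τ : Perm n) → sign (σ ∘' τ) ≡ sign σ xor sign τ
sign-∘ σ τ = begin
  sign (σ ∘' τ)
    ≡⟨ sign≡∑²flips (σ ∘' τ) ⟩
  ∑² (λ i j → lt i j ∧ flips (σ ∘' τ) i j)
    ≡⟨ ∑²-cong (λ i j → trans (cong (lt i j ∧_) (flips-∘ σ τ i j))
                              (∧-distribˡ-xor (lt i j) (flips σ (τ ⟨$⟩ʳ i) (τ ⟨$⟩ʳ j)) (flips τ i j))) ⟩
  ∑² (λ i j → (lt i j ∧ flips σ (τ ⟨$⟩ʳ i) (τ ⟨$⟩ʳ j)) xor (lt i j ∧ flips τ i j))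
    ≡⟨ ∑²-xor (λ i j → lt i j ∧ flips σ (τ ⟨$⟩ʳ i) (τ ⟨$⟩ʳ j)) (λ i j → lt i j ∧ flips τ i j) ⟩
  ∑² (λ i j → lt i j ∧ flips σ (τ ⟨$⟩ʳ i) (τ ⟨$⟩ʳ j)) xor ∑² (λ i j → lt i j ∧ flips τ i j)
    ≡⟨ cong₂ _xor_ relabelled (sign≡∑²flips τ) ⟨
  sign σ xor sign τ ∎
  where
  open ≡-Reasoning
  relabelled : sign σ ≡ ∑² (λ i j → lt i j ∧ flips σ (τ ⟨$⟩ʳ i) (τ ⟨$⟩ʳ j))
  relabelled = begin
    sign σ
      ≡⟨ sign≡∑²flips σ ⟩
    ∑² (λ p q → lt p q ∧ flips σ p q)
      ≡⟨ ∑²-relabel (flip τ) (flips σ) (flips-sym σ) ⟨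
    ∑² (λ p q → lt (τ ⟨$⟩ˡ p) (τ ⟨$⟩ˡ q) ∧ flips σ p q)
      ≡⟨ ∑²-permute (λ p q → lt (τ ⟨$⟩ˡ p) (τ ⟨$⟩ˡ q) ∧ flips σ p q) τ ⟩
    ∑² (λ i j → lt (τ ⟨$⟩ˡ (τ ⟨$⟩ʳ i)) (τ ⟨$⟩ˡ (τ ⟨$⟩ʳ j)) ∧ flips σ (τ ⟨$⟩ʳ i) (τ ⟨$⟩ʳ j))
      ≡⟨ ∑²-cong (λ i j → cong₂ (λ p q → lt p q ∧ flips σ (τ ⟨$⟩ʳ i) (τ ⟨$⟩ʳ j))
                                (inverseˡ τ) (inverseˡ τ)) ⟩
    ∑² (λ i j → lt i j ∧ flips σ (τ ⟨$⟩ʳ i) (τ ⟨$⟩ʳ j)) ∎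

sign-cong : ∀ {n} (σ τ : Perm n) → σ ≈ₚ τ → sign σ ≡ sign τ
sign-cong σ τ σ≈τ = begin
  sign σ                                          ≡⟨ sign≡∑²inversions σ ⟩
  ∑² (λ i j → lt i j ∧ lt (σ ⟨$⟩ʳ j) (σ ⟨$⟩ʳ i))
    ≡⟨ ∑²-cong (λ i j → cong₂ (λ p q → lt i j ∧ lt p q) (σ≈τ j) (σ≈τ i)) ⟩
  ∑² (λ i j → lt i j ∧ lt (τ ⟨$⟩ʳ j) (τ ⟨$⟩ʳ i))  ≡⟨ sign≡∑²inversions τ ⟨
  sign τ                                          ∎
  where open ≡-Reasoning

-- Transpositions and 3-cycles

transpose-matchˡ : ∀ {n} (i j : Fin n) → PC.transpose i j i ≡ j
transpose-matchˡ i j rewrite dec-true (i ≟ i) refl = refl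

transpose-matchʳ : ∀ {n} (i j : Fin n) → PC.transpose i j j ≡ i
transpose-matchʳ i j with j ≟ i
... | yes j≡i = j≡i
... | no  j≢i rewrite dec-true (j ≟ j) refl = refl

transpose-mismatch : ∀ {n} {i j k : Fin n} → k ≢ i → k ≢ j → PC.transpose i j k ≡ k
transpose-mismatch {i = i} {j} {k} k≢i k≢j rewrite dec-false (k ≟ i) k≢i | dec-false (k ≟ j) k≢j = refl

transpose-same : ∀ {n} (i k : Fin n) → PC.transpose i i k ≡ k
transpose-same i k with i ≟ k
... | yes refl = transpose-matchˡ k k
... | no  i≢k  = transpose-mismatch (≢-sym i≢k) (≢-sym i≢k)

transpose-comm : ∀ {n} (i j k : Fin n) → PC.transpose i j k ≡ PC.transpose j i k
transpose-comm i j k with i ≟ k | j ≟ k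
... | yes refl | yes refl = refl
... | yes refl | no  j≢k  = trans (transpose-matchˡ k j) (sym (transpose-matchʳ j k))
... | no  i≢k  | yes refl = trans (transpose-matchʳ i k) (sym (transpose-matchˡ k i))
... | no  i≢k  | no  j≢k  = trans (transpose-mismatch (≢-sym i≢k) (≢-sym j≢k))
                                  (sym (transpose-mismatch (≢-sym j≢k) (≢-sym i≢k)))

star : ∀ {m} → Fin m → Perm (suc m)
star k = transpose zero (suc k)

star-at-a : ∀ {m} (a : Fin m) → star a ⟨$⟩ʳ suc a ≡ zero
star-at-a a = transpose-matchʳ zero (suc a)

star-fix : ∀ {m} {a y : Fin m} → y ≢ a → star a ⟨$⟩ʳ suc y ≡ suc y
star-fix {a = a} y≢a = transpose-mismatch {i = zero} {j = suc a} (λ ()) (y≢a ∘ suc-injective)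

-- star zero swaps 0 and 1, so (0, 1) is its only inversion; the other stars are conjugate to it.
sign-star : ∀ {m} (k : Fin m) → sign (star k) ≡ true
sign-star {suc m} zero = trans (sign≡∑²inversions t) (cong₂ _xor_ row-0 (cong₂ _xor_ row-1 rows-≥2))
  where
  t : Perm (2 + m)
  t = star zero
  ∑-false : ∀ {n} (f : Fin n → Bool) → (∀ i → f i ≡ false) → ∑[ i < n ] f i ≡ false
  ∑-false {zero}  f _     = refl
  ∑-false {suc n} f f≡0 rewrite f≡0 zero = ∑-false (f ∘ suc) (f≡0 ∘ suc)
  row-0 : ∑[ j < 2 + m ] (lt zero j ∧ lt (t ⟨$⟩ʳ j) (suc zero)) ≡ true
  row-0 = cong (λ b → false xor (true xor b))
               (∑-false (λ k → lt zero (suc (suc k)) ∧ lt (t ⟨$⟩ʳ suc (suc k)) (suc zero)) (λ _ → refl))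
  row-1 : ∑[ j < 2 + m ] (lt (suc zero) j ∧ lt (t ⟨$⟩ʳ j) zero) ≡ false
  row-1 = ∑-false (λ j → lt (suc zero) j ∧ lt (t ⟨$⟩ʳ j) zero) (λ j → ∧-zeroʳ (lt (suc zero) j))
  rows-≥2 : ∑[ i < m ] ∑[ j < 2 + m ] (lt (suc (suc i)) j ∧ lt (t ⟨$⟩ʳ j) (suc (suc i))) ≡ false
  rows-≥2 = ∑-false (λ i → ∑[ j < 2 + m ] entry i j) (λ i → ∑-false (entry i) (entry≡false i))
    where
    entry : Fin m → Fin (2 + m) → Bool
    entry i j = lt (suc (suc i)) j ∧ lt (t ⟨$⟩ʳ j) (suc (suc i))
    entry≡false : ∀ i j → entry i j ≡ false
    entry≡false i zero          = refl
    entry≡false i (suc zero)    = refl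
    entry≡false i (suc (suc j)) = <ᵇ-asym (toℕ i) (toℕ j)
sign-star {suc m} (suc l) = begin
  sign (star (suc l))                ≡⟨ sign-cong (star (suc l)) (t ∘' (s₀ ∘' t)) conjugate ⟩
  sign (t ∘' (s₀ ∘' t))              ≡⟨ sign-∘ t (s₀ ∘' t) ⟩
  sign t xor sign (s₀ ∘' t)          ≡⟨ cong (sign t xor_) (sign-∘ s₀ t) ⟩
  sign t xor (sign s₀ xor sign t)    ≡⟨ cong (λ b → sign t xor (b xor sign t)) (sign-star {suc m} zero) ⟩
  sign t xor (true xor sign t)       ≡⟨ xor-inverseʳ (sign t) ⟩
  true                               ∎
  where
  open ≡-Reasoning
  s₀ t : Perm (2 + m)
  s₀ = star zero
  t  = transpose (suc zero) (suc (suc l))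
  conjugate : star (suc l) ≈ₚ (t ∘' (s₀ ∘' t))
  conjugate zero          = refl
  conjugate (suc zero)    = sym (transpose-matchʳ (suc zero) (suc (suc l)))
  conjugate (suc (suc y)) with l ≟ y
  ... | yes refl = trans (transpose-matchʳ zero (suc (suc l)))
                         (sym (cong (λ z → t ⟨$⟩ʳ (s₀ ⟨$⟩ʳ z)) (transpose-matchʳ (suc zero) (suc (suc l)))))
  ... | no  l≢y  = trans (star-fix (≢-sym l≢y ∘ suc-injective))
                         (sym (trans (cong (λ z → t ⟨$⟩ʳ (s₀ ⟨$⟩ʳ z)) t-fix) t-fix))
    where
    t-fix : t ⟨$⟩ʳ suc (suc y) ≡ suc (suc y)
    t-fix = transpose-mismatch {i = suc zero} {j = suc (suc l)} (λ ())
                               (≢-sym l≢y ∘ suc-injective ∘ suc-injective)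

data Position {m} (a b : Fin m) : Fin (suc m) → Set where
  at-0 : Position a b zero
  at-a : Position a b (suc a)
  at-b : Position a b (suc b)
  off  : ∀ {y} → y ≢ a → y ≢ b → Position a b (suc y)

position : ∀ {m} (a b : Fin m) x → Position a b x
position a b zero = at-0
position a b (suc y) with y ≟ a | y ≟ b
... | yes refl | _        = at-a
... | no  _    | yes refl = at-b
... | no  y≢a  | no  y≢b  = off y≢a y≢b

-- The 3-cycle 0 ↦ suc a ↦ suc b ↦ 0.
cycle : ∀ {m} → Fin m → Fin m → Perm (suc m)
cycle a b = star a ∘ₚ star b

cycle-a : ∀ {m} (a b : Fin m) → cycle a b ⟨$⟩ʳ suc a ≡ suc b
cycle-a a b = cong (star b ⟨$⟩ʳ_) (star-at-a a)

cycle⁻¹-b : ∀ {m} (a b : Fin m) → cycle a b ⟨$⟩ˡ suc b ≡ suc a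
cycle⁻¹-b a b = Inverse.inverseʳ (cycle a b) (sym (cycle-a a b))

module _ {m} {a b : Fin m} where

  cycle-0 : a ≢ b → cycle a b ⟨$⟩ʳ zero ≡ suc a
  cycle-0 a≢b = star-fix a≢b

  cycle-b : a ≢ b → cycle a b ⟨$⟩ʳ suc b ≡ zero
  cycle-b a≢b = trans (cong (star b ⟨$⟩ʳ_) (star-fix (≢-sym a≢b))) (star-at-a b)

  cycle-fix : ∀ {y} → y ≢ a → y ≢ b → cycle a b ⟨$⟩ʳ suc y ≡ suc y
  cycle-fix y≢a y≢b = trans (cong (star b ⟨$⟩ʳ_) (star-fix y≢a)) (star-fix y≢b)

  cycle⁻¹-0 : a ≢ b → cycle a b ⟨$⟩ˡ zero ≡ suc b
  cycle⁻¹-0 a≢b = Inverse.inverseʳ (cycle a b) (sym (cycle-b a≢b))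

  cycle⁻¹-a : a ≢ b → cycle a b ⟨$⟩ˡ suc a ≡ zero
  cycle⁻¹-a a≢b = Inverse.inverseʳ (cycle a b) (sym (cycle-0 a≢b))

  cycle⁻¹-fix : ∀ {y} → y ≢ a → y ≢ b → cycle a b ⟨$⟩ˡ suc y ≡ suc y
  cycle⁻¹-fix y≢a y≢b = Inverse.inverseʳ (cycle a b) (sym (cycle-fix y≢a y≢b))

module _ {m} {a b : Fin m} where

  private
    orbit : ∀ x {y z w} → cycle a b ⟨$⟩ʳ x ≡ y → cycle a b ⟨$⟩ʳ y ≡ z → cycle a b ⟨$⟩ʳ z ≡ w →
            cycle a b ⟨$⟩ʳ (cycle a b ⟨$⟩ʳ (cycle a b ⟨$⟩ʳ x)) ≡ w
    orbit _ refl refl refl = refl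

    square : ∀ x {y z} → cycle a b ⟨$⟩ʳ x ≡ y → cycle a b ⟨$⟩ʳ y ≡ z → cycle b a ⟨$⟩ʳ x ≡ z →
             cycle a b ⟨$⟩ʳ (cycle a b ⟨$⟩ʳ x) ≡ cycle b a ⟨$⟩ʳ x
    square _ refl refl eq = sym eq

    split : ∀ {c} x {y w} → cycle a b ⟨$⟩ʳ x ≡ w → cycle a c ⟨$⟩ʳ x ≡ y → cycle c b ⟨$⟩ʳ y ≡ w →
            cycle a b ⟨$⟩ʳ x ≡ cycle c b ⟨$⟩ʳ (cycle a c ⟨$⟩ʳ x)
    split _ eq refl refl = eq

  cycle-cube : a ≢ b → ∀ x → cycle a b ⟨$⟩ʳ (cycle a b ⟨$⟩ʳ (cycle a b ⟨$⟩ʳ x)) ≡ x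
  cycle-cube a≢b x with position a b x
  ... | at-0              = orbit zero (cycle-0 a≢b) (cycle-a a b) (cycle-b a≢b)
  ... | at-a              = orbit (suc a) (cycle-a a b) (cycle-b a≢b) (cycle-0 a≢b)
  ... | at-b              = orbit (suc b) (cycle-b a≢b) (cycle-0 a≢b) (cycle-a a b)
  ... | off {y} y≢a y≢b   = orbit (suc y) (cycle-fix y≢a y≢b) (cycle-fix y≢a y≢b) (cycle-fix y≢a y≢b)

  cycle-square : a ≢ b → (cycle a b ∘' cycle a b) ≈ₚ cycle b a
  cycle-square a≢b x with position a b x
  ... | at-0              = square zero (cycle-0 a≢b) (cycle-a a b) (cycle-0 (≢-sym a≢b))
  ... | at-a              = square (suc a) (cycle-a a b) (cycle-b a≢b) (cycle-b (≢-sym a≢b))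
  ... | at-b              = square (suc b) (cycle-b a≢b) (cycle-0 a≢b) (cycle-a b a)
  ... | off {y} y≢a y≢b   = square (suc y) (cycle-fix y≢a y≢b) (cycle-fix y≢a y≢b) (cycle-fix y≢b y≢a)

  cycle-split : ∀ {c} → a ≢ b → a ≢ c → c ≢ b → cycle a b ≈ₚ (cycle c b ∘' cycle a c)
  cycle-split {c} a≢b a≢c c≢b x with position a b x
  ... | at-0              = split zero (cycle-0 a≢b) (cycle-0 a≢c) (cycle-fix a≢c a≢b)
  ... | at-a              = split (suc a) (cycle-a a b) (cycle-a a c) (cycle-a c b)
  ... | at-b              = split (suc b) (cycle-b a≢b) (cycle-fix (≢-sym a≢b) (≢-sym c≢b)) (cycle-b c≢b)
  ... | off {y} y≢a y≢b with y ≟ c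
  ...   | yes refl        = split (suc y) (cycle-fix y≢a y≢b) (cycle-b a≢c) (cycle-0 c≢b)
  ...   | no  y≢c         = split (suc y) (cycle-fix y≢a y≢b) (cycle-fix y≢a y≢c) (cycle-fix y≢c y≢b)

cycle-self : ∀ {m} (a : Fin m) → cycle a a ≈ₚ idₚ
cycle-self a x = trans (cong (star a ⟨$⟩ʳ_) (transpose-comm zero (suc a) x))
                       (PC.transpose-inverse zero (suc a))

stars : ∀ {m} → List (Fin m) → Perm (suc m)
stars []       = idₚ
stars (k ∷ ks) = star k ∘ₚ stars ks

stars-++ : ∀ {m} (ks ls : List (Fin m)) x →
           stars (ks ++ ls) ⟨$⟩ʳ x ≡ stars ls ⟨$⟩ʳ (stars ks ⟨$⟩ʳ x)
stars-++ []       ls x = refl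
stars-++ (k ∷ ks) ls x = stars-++ ks ls (star k ⟨$⟩ʳ x)

-- (suc a, suc b) is the conjugate of star b by star a.
transposition-word : ∀ {m} → Fin (suc m) → Fin (suc m) → List (Fin m)
transposition-word zero    zero    = []
transposition-word zero    (suc b) = [ b ]
transposition-word (suc a) zero    = [ a ]
transposition-word (suc a) (suc b) with a ≟ b
... | yes _ = []
... | no  _ = a ∷ b ∷ a ∷ []

transpose≈stars : ∀ {m} (i j : Fin (suc m)) → transpose i j ≈ₚ stars (transposition-word i j)
transpose≈stars zero    zero    x = transpose-same zero x
transpose≈stars zero    (suc b) x = refl
transpose≈stars (suc a) zero    x = transpose-comm (suc a) zero x
transpose≈stars (suc a) (suc b) x with a ≟ b
... | yes refl = transpose-same (suc a) x
... | no  a≢b  = conjugate x (position a b x)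
  where
  conjugated : ∀ x {y z w} → star a ⟨$⟩ʳ x ≡ y → star b ⟨$⟩ʳ y ≡ z → star a ⟨$⟩ʳ z ≡ w →
               stars (a ∷ b ∷ a ∷ []) ⟨$⟩ʳ x ≡ w
  conjugated _ refl refl refl = refl
  conjugate : ∀ x → Position a b x →
              PC.transpose (suc a) (suc b) x ≡ stars (a ∷ b ∷ a ∷ []) ⟨$⟩ʳ x
  conjugate _ at-0 = trans (transpose-mismatch {i = suc a} {j = suc b} (λ ()) (λ ()))
                           (sym (conjugated zero refl (star-fix a≢b) (star-at-a a)))
  conjugate _ at-a = trans (transpose-matchˡ (suc a) (suc b))
                           (sym (conjugated (suc a) (star-at-a a) refl (star-fix (≢-sym a≢b))))
  conjugate _ at-b = trans (transpose-matchʳ (suc a) (suc b))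
                           (sym (conjugated (suc b) (star-fix (≢-sym a≢b)) (star-at-a b) refl))
  conjugate _ (off {y} y≢a y≢b) =
    trans (transpose-mismatch (y≢a ∘ suc-injective) (y≢b ∘ suc-injective))
          (sym (conjugated (suc y) (star-fix y≢a) (star-fix y≢b) (star-fix y≢a)))

∃-stars : ∀ {m} (σ : Perm (suc m)) → ∃ λ ks → σ ≈ₚ stars ks
∃-stars {m} σ = word (decompose σ) , λ x → trans (sym (eval-decompose σ x)) (eval≈stars (decompose σ) x)
  where
  word : TranspositionList (suc m) → List (Fin m)
  word []             = []
  word ((i , j) ∷ ts) = transposition-word i j ++ word ts
  eval≈stars : ∀ ts → eval ts ≈ₚ stars (word ts)
  eval≈stars []             x = refl
  eval≈stars ((i , j) ∷ ts) x = begin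
    eval ts ⟨$⟩ʳ (transpose i j ⟨$⟩ʳ x)
      ≡⟨ eval≈stars ts _ ⟩
    stars (word ts) ⟨$⟩ʳ (transpose i j ⟨$⟩ʳ x)
      ≡⟨ cong (stars (word ts) ⟨$⟩ʳ_) (transpose≈stars i j x) ⟩
    stars (word ts) ⟨$⟩ʳ (stars (transposition-word i j) ⟨$⟩ʳ x)
      ≡⟨ stars-++ (transposition-word i j) (word ts) x ⟨
    stars (transposition-word i j ++ word ts) ⟨$⟩ʳ x ∎
    where open ≡-Reasoning

cycles : ∀ {m} → List (Fin m × Fin m) → Perm (suc m)
cycles []             = idₚ
cycles ((a , b) ∷ ps) = cycle a b ∘ₚ cycles ps

sign-cycle : ∀ {m} (a b : Fin m) → sign (cycle a b) ≡ false
sign-cycle a b = trans (sign-∘ (star b) (star a)) (cong₂ _xor_ (sign-star b) (sign-star a))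

cycle-even : ∀ {m} (a b : Fin m) → IsEven (cycle a b)
cycle-even a b = ¬odd⇒%2≡0 (inversions (cycle a b)) (sign-cycle a b)

even-stars⇒cycles : ∀ {m} (ks : List (Fin m)) → sign (stars ks) ≡ false →
                    ∃ λ ps → stars ks ≈ₚ cycles ps
even-stars⇒cycles []           _    = [] , λ _ → refl
even-stars⇒cycles (k ∷ [])     even =
  contradiction (trans (sym (sign-star k)) (trans (sign-cong (star k) (stars [ k ]) (λ _ → refl)) even))
                λ ()
even-stars⇒cycles (a ∷ b ∷ ks) even = (a , b) ∷ proj₁ rest , λ x → proj₂ rest (cycle a b ⟨$⟩ʳ x)
  where
  open ≡-Reasoning
  sign-ks : sign (stars ks) ≡ false
  sign-ks = begin
    sign (stars ks)                       ≡⟨ xor-identityʳ (sign (stars ks)) ⟨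
    sign (stars ks) xor false             ≡⟨ cong (sign (stars ks) xor_) (sign-cycle a b) ⟨
    sign (stars ks) xor sign (cycle a b)  ≡⟨ sign-∘ (stars ks) (cycle a b) ⟨
    sign (stars ks ∘' cycle a b)          ≡⟨ sign-cong (stars ks ∘' cycle a b) (stars (a ∷ b ∷ ks))
                                                       (λ _ → refl) ⟩
    sign (stars (a ∷ b ∷ ks))             ≡⟨ even ⟩
    false                                 ∎
  rest : ∃ λ ps → stars ks ≈ₚ cycles ps
  rest = even-stars⇒cycles ks sign-ks

even⇒cycles : ∀ {m} (σ : Perm (suc m)) → IsEven σ → ∃ λ ps → σ ≈ₚ cycles ps
even⇒cycles σ even = proj₁ by-cycles , λ x → trans (proj₂ by-stars x) (proj₂ by-cycles x)
  where
  by-stars : ∃ λ ks → σ ≈ₚ stars ks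
  by-stars = ∃-stars σ
  sign-stars : sign (stars (proj₁ by-stars)) ≡ false
  sign-stars = trans (sym (sign-cong σ (stars (proj₁ by-stars)) (proj₂ by-stars)))
                     (%2≡0⇒¬odd (inversions σ) even)
  by-cycles : ∃ λ ps → stars (proj₁ by-stars) ≈ₚ cycles ps
  by-cycles = even-stars⇒cycles (proj₁ by-stars) sign-stars

-- Vectors supported on three points

∃-∉-image : ∀ {k n} → k < n → (f : Fin k → Fin n) → ∃ λ o → ∀ i → o ≢ f i
∃-∉-image {k} {n} k<n f with ¬∀⟶∃¬ n (λ o → ∃ λ i → o ≡ f i) (λ o → any? (λ i → o ≟ f i)) f-not-onto
  where
  f-not-onto : ¬ (∀ o → ∃ λ i → o ≡ f i)
  f-not-onto onto = <⇒notInjective k<n preimage-injective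
    where
    preimage-injective : ∀ {o o′} → proj₁ (onto o) ≡ proj₁ (onto o′) → o ≡ o′
    preimage-injective {o} {o′} eq = trans (proj₂ (onto o)) (trans (cong f eq) (sym (proj₂ (onto o′))))
... | o , o∉ = o , λ i o≡fi → o∉ (i , o≡fi)

fresh₃ : ∀ {n} (a b c : Fin (4 + n)) → ∃ λ o → o ≢ a × o ≢ b × o ≢ c
fresh₃ {n} a b c with ∃-∉-image (s≤s (s≤s (s≤s (s≤s z≤n)))) abc
  where
  abc : Fin 3 → Fin (4 + n)
  abc zero             = a
  abc (suc zero)       = b
  abc (suc (suc zero)) = c
... | o , o∉ = o , o∉ zero , o∉ (suc zero) , o∉ (suc (suc zero))

other : ∀ {m} → Fin (2 + m) → Fin (2 + m)
other zero    = suc zero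
other (suc _) = zero

other-≢ : ∀ {m} (a : Fin (2 + m)) → other a ≢ a
other-≢ zero    ()
other-≢ (suc _) ()

pair₀ : ∀ {m} → Fin m → Vect (suc m)
pair₀ x zero    = true
pair₀ x (suc y) = does (y ≟ x)

pair₀-self : ∀ {m} (x : Fin m) → pair₀ x (suc x) ≡ true
pair₀-self x = dec-true (x ≟ x) refl

pair₀-other : ∀ {m} {x y : Fin m} → y ≢ x → pair₀ x (suc y) ≡ false
pair₀-other {x = x} {y} y≢x = dec-false (y ≟ x) y≢x

infixl 6 _⊕_
_⊕_ : ∀ {d} → Vect d → Vect d → Vect d
(v ⊕ w) i = v i xor w i

record EvenOn {m} (a b : Fin m) (z : Vect (suc m)) : Set where
  field
    even-at-0 : z zero ≡ z (suc a) xor z (suc b)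
    outside   : ∀ {y} → y ≢ a → y ≢ b → z (suc y) ≡ false

open EvenOn

module _ {m} {a b : Fin m} where

  EvenOn-at-b : ∀ {z} → EvenOn a b z → z (suc b) ≡ z zero xor z (suc a)
  EvenOn-at-b {z} z-even =
    sym (trans (cong (_xor z (suc a)) (even-at-0 z-even)) (xor-cancelʳ (z (suc a)) (z (suc b))))

  EvenOn-swap : ∀ {z} → EvenOn a b z → EvenOn b a z
  EvenOn-swap {z} z-even = record
    { even-at-0 = trans (even-at-0 z-even) (xor-comm (z (suc a)) (z (suc b)))
    ; outside   = λ y≢b y≢a → outside z-even y≢a y≢b
    }

  EvenOn-⊕ : ∀ {y z} → EvenOn a b y → EvenOn a b z → EvenOn a b (y ⊕ z)
  EvenOn-⊕ {y} {z} y-even z-even = record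
    { even-at-0 = trans (cong₂ _xor_ (even-at-0 y-even) (even-at-0 z-even))
                        (xor-interchange (y (suc a)) (y (suc b)) (z (suc a)) (z (suc b)))
    ; outside   = λ y≢a y≢b → cong₂ _xor_ (outside y-even y≢a y≢b) (outside z-even y≢a y≢b)
    }

  EvenOn-coboundary : a ≢ b → (v : Vect (suc m)) → EvenOn a b (v ⊕ act (cycle a b) v)
  EvenOn-coboundary a≢b v = record
    { even-at-0 = begin
        v zero xor v (cycle a b ⟨$⟩ˡ zero)
          ≡⟨ cong (λ j → v zero xor v j) (cycle⁻¹-0 a≢b) ⟩
        v zero xor v (suc b)
          ≡⟨ xor-telescope (v zero) (v (suc a)) (v (suc b)) ⟩
        (v zero xor v (suc a)) xor (v (suc a) xor v (suc b))
          ≡⟨ cong₂ _xor_ (xor-comm (v zero) (v (suc a))) (xor-comm (v (suc a)) (v (suc b))) ⟩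
        (v (suc a) xor v zero) xor (v (suc b) xor v (suc a))
          ≡⟨ cong₂ (λ i j → (v (suc a) xor v i) xor (v (suc b) xor v j))
                   (cycle⁻¹-a a≢b) (cycle⁻¹-b a b) ⟨
        (v (suc a) xor v (cycle a b ⟨$⟩ˡ suc a)) xor (v (suc b) xor v (cycle a b ⟨$⟩ˡ suc b)) ∎
    ; outside = λ {y} y≢a y≢b →
        trans (cong (λ j → v (suc y) xor v j) (cycle⁻¹-fix y≢a y≢b)) (xor-same (v (suc y)))
    }
    where open ≡-Reasoning

  EvenOn-decompose : ∀ {z} → a ≢ b → EvenOn a b z →
                     ∀ i → z i ≡ (pair₀ a i ∧ z (suc a)) xor (pair₀ b i ∧ z (suc b))
  EvenOn-decompose {z} a≢b z-even i with position a b i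
  ... | at-0 = even-at-0 z-even
  ... | at-a rewrite pair₀-self a | pair₀-other a≢b = sym (xor-identityʳ (z (suc a)))
  ... | at-b rewrite pair₀-self b | pair₀-other (≢-sym a≢b) = refl
  ... | off y≢a y≢b rewrite pair₀-other y≢a | pair₀-other y≢b = outside z-even y≢a y≢b

  EvenOn-vanishes : ∀ {z} → a ≢ b → EvenOn a b z → z (suc a) ≡ false → z zero ≡ false →
                    ∀ i → z i ≡ false
  EvenOn-vanishes {z} a≢b z-even za z0 i with position a b i
  ... | at-0 = z0
  ... | at-a = za
  ... | at-b = trans (EvenOn-at-b z-even) (cong₂ _xor_ z0 za)
  ... | off y≢a y≢b = outside z-even y≢a y≢b

  EvenOn-pair₀ : ∀ {z} → a ≢ b → EvenOn a b z → z zero ≡ true → z (suc a) ≡ true →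
                 ∀ i → z i ≡ pair₀ a i
  EvenOn-pair₀ {z} a≢b z-even z0 za i with position a b i
  ... | at-0 = z0
  ... | at-a = trans za (sym (pair₀-self a))
  ... | at-b = trans (EvenOn-at-b z-even) (trans (cong₂ _xor_ z0 za) (sym (pair₀-other (≢-sym a≢b))))
  ... | off y≢a y≢b = trans (outside z-even y≢a y≢b) (sym (pair₀-other y≢a))

-- The splitting

≈ₚ⇒≈ˡ : ∀ {d} {σ τ : Perm d} → σ ≈ₚ τ → ∀ i → σ ⟨$⟩ˡ i ≡ τ ⟨$⟩ˡ i
≈ₚ⇒≈ˡ {σ = σ} {τ} σ≈τ i = Inverse.inverseʳ σ (sym (trans (σ≈τ (τ ⟨$⟩ˡ i)) (inverseʳ τ)))

≈W-sym : ∀ {d} {x y : W d} → x ≈W y → y ≈W x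
≈W-sym (v≗w , σ≈τ) = (λ i → sym (v≗w i)) , (λ i → sym (σ≈τ i))

-- The standard complement {(0, σ)} conjugated by the translation (v, id).
section : ∀ {d} → Vect d → Perm d → W d
section v σ = v ⊕ act σ v , σ

section-cong : ∀ {d} (v : Vect d) σ τ → σ ≈ₚ τ → section v σ ≈W section v τ
section-cong v σ τ σ≈τ = (λ i → cong (λ j → v i xor v j) (≈ₚ⇒≈ˡ {σ = σ} {τ} σ≈τ i)) , σ≈τ

section-∘ : ∀ {d} (v : Vect d) σ τ → section v (σ ∘' τ) ≈W (section v σ · section v τ)
section-∘ v σ τ = (λ i → xor-telescope (v i) (v (σ ⟨$⟩ˡ i)) (v (τ ⟨$⟩ˡ (σ ⟨$⟩ˡ i)))) , λ _ → refl

module Kernel {d} {G : W d → Set} (G-subgroup : IsSubgroup G) where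

  open IsSubgroup G-subgroup public

  K : Vect d → Set
  K y = G (y , idₚ)

  G-≗ : ∀ {v w σ} → (∀ i → v i ≡ w i) → G (v , σ) → G (w , σ)
  G-≗ v≗w = resp _ _ (v≗w , λ _ → refl)

  K-⊕ : ∀ {y z} → K y → K z → K (y ⊕ z)
  K-⊕ y∈K z∈K = resp _ _ ((λ _ → refl) , (λ _ → refl)) (closed· _ _ y∈K z∈K)

  K-scale : ∀ {y} c → K y → K (λ i → y i ∧ c)
  K-scale {y} false _   = G-≗ (λ i → sym (∧-zeroʳ (y i))) hasId
  K-scale {y} true  y∈K = G-≗ (λ i → sym (∧-identityʳ (y i))) y∈K

  K-act : ∀ {u σ y} → G (u , σ) → K y → K (act σ y)
  K-act {u} {σ} {y} g∈G y∈K = resp _ _ (cancel , λ i → inverseʳ σ)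
    (closed· _ _ (closed· _ _ g∈G y∈K) (closed⁻¹ _ g∈G))
    where
    cancel : ∀ i → (u i xor y (σ ⟨$⟩ˡ i)) xor u (σ ⟨$⟩ʳ (σ ⟨$⟩ˡ i)) ≡ y (σ ⟨$⟩ˡ i)
    cancel i = trans (cong (λ j → (u i xor y (σ ⟨$⟩ˡ i)) xor u j) (inverseʳ σ))
                     (xor-cancelʳ (u i) (y (σ ⟨$⟩ˡ i)))

  lifts-differ : ∀ {p q σ τ} → G (p , σ) → G (q , τ) → σ ≈ₚ τ → K (p ⊕ q)
  lifts-differ {p} {q} {σ} {τ} p∈G q∈G σ≈τ =
    resp _ _ (same-q , λ i → trans (σ≈τ (τ ⟨$⟩ˡ i)) (inverseʳ τ)) (closed· _ _ p∈G (closed⁻¹ _ q∈G))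
    where
    same-q : ∀ i → p i xor q (τ ⟨$⟩ʳ (σ ⟨$⟩ˡ i)) ≡ p i xor q i
    same-q i = cong (λ j → p i xor q j) (trans (sym (σ≈τ (σ ⟨$⟩ˡ i))) (inverseʳ σ))

module Splitting {n} (G : W (5 + n) → Set) (G-subgroup : IsSubgroup G) (π-surjective : ProjSurjective G)
  where

  open Kernel G-subgroup

  lift : Fin (4 + n) → Fin (4 + n) → Vect (5 + n)
  lift a b = proj₁ (proj₁ (π-surjective (cycle a b) (cycle-even a b)))

  G-lift : ∀ a b → G (lift a b , cycle a b)
  G-lift a b = resp _ _ ((λ _ → refl) , proj₂ (proj₂ lifted)) (proj₁ (proj₂ lifted))
    where
    lifted : ∃ λ x → G x × proj x ≈ₚ cycle a b
    lifted = π-surjective (cycle a b) (cycle-even a b)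

  -- g³ is a translation fixed by c, so the translation part of g⁴ = g · g³ vanishes off the support of c.
  u : Fin (4 + n) → Fin (4 + n) → Vect (5 + n)
  u a b = proj₁ (((g · g) · g) · g)
    where
    g : W (5 + n)
    g = lift a b , cycle a b

  G-u : ∀ {a b} → a ≢ b → G (u a b , cycle a b)
  G-u {a} {b} a≢b = resp _ _ ((λ _ → refl) , λ x → cycle-cube a≢b (cycle a b ⟨$⟩ʳ x))
    (closed· _ _ (closed· _ _ (closed· _ _ (G-lift a b) (G-lift a b)) (G-lift a b)) (G-lift a b))

  u-at : ∀ {a b i p q r} → cycle a b ⟨$⟩ˡ i ≡ p → cycle a b ⟨$⟩ˡ p ≡ q → cycle a b ⟨$⟩ˡ q ≡ r →
         u a b i ≡ ((lift a b i xor lift a b p) xor lift a b q) xor lift a b r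
  u-at refl refl refl = refl

  u-EvenOn : ∀ {a b} → a ≢ b → EvenOn a b (u a b)
  u-EvenOn {a} {b} a≢b = record
    { even-at-0 = trans (u-at c⁻¹0 c⁻¹b c⁻¹a)
                        (trans (identity (w zero) (w (suc a)) (w (suc b)))
                               (sym (cong₂ _xor_ (u-at c⁻¹a c⁻¹0 c⁻¹b) (u-at c⁻¹b c⁻¹a c⁻¹0))))
    ; outside   = λ {y} y≢a y≢b →
        trans (u-at (cycle⁻¹-fix y≢a y≢b) (cycle⁻¹-fix y≢a y≢b) (cycle⁻¹-fix y≢a y≢b)) (vanish (w (suc y)))
    }
    where
    w : Vect (5 + n)
    w = lift a b
    c⁻¹0 : cycle a b ⟨$⟩ˡ zero ≡ suc b
    c⁻¹0 = cycle⁻¹-0 a≢b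
    c⁻¹a : cycle a b ⟨$⟩ˡ suc a ≡ zero
    c⁻¹a = cycle⁻¹-a a≢b
    c⁻¹b : cycle a b ⟨$⟩ˡ suc b ≡ suc a
    c⁻¹b = cycle⁻¹-b a b
    -- The three sides are u a b at 0, suc a and suc b, with x, y, z the values of w there.
    identity : ∀ x y z → ((x xor z) xor y) xor x ≡ (((y xor x) xor z) xor y) xor (((z xor y) xor x) xor z)
    identity false false false = refl
    identity false false true  = refl
    identity false true  false = refl
    identity false true  true  = refl
    identity true  false false = refl
    identity true  false true  = refl
    identity true  true  false = refl
    identity true  true  true  = refl
    vanish : ∀ x → ((x xor x) xor x) xor x ≡ false
    vanish x = trans (cong (λ t → (t xor x) xor x) (xor-same x)) (xor-same x)

  K-full : Set
  K-full = ∀ x → K (pair₀ x)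

  K-full⇒EvenOn⊆K : ∀ {a b z} → K-full → a ≢ b → EvenOn a b z → K z
  K-full⇒EvenOn⊆K {a} {b} {z} full a≢b z-even = G-≗ (λ i → sym (EvenOn-decompose a≢b z-even i))
    (K-⊕ (K-scale (z (suc a)) (full a)) (K-scale (z (suc b)) (full b)))

  -- y + c·y = pair₀ x, where c = cycle x o if y (suc o) = y (suc x) and c = cycle o x otherwise.
  pair₀∈K : ∀ {x o y} → o ≢ x → K y → y zero xor y (suc x) ≡ true → K (pair₀ x)
  pair₀∈K {x} {o} {y} o≢x y∈K differ with y (suc o) ≟ᵇ y (suc x)
  ... | yes yo≡yx = G-≗ (EvenOn-pair₀ (≢-sym o≢x) (EvenOn-coboundary (≢-sym o≢x) y) one-at-0 one-at-x)
                        (K-⊕ y∈K (K-act (G-lift x o) y∈K))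
    where
    one-at-0 : y zero xor y (cycle x o ⟨$⟩ˡ zero) ≡ true
    one-at-0 = trans (cong (λ j → y zero xor y j) (cycle⁻¹-0 (≢-sym o≢x)))
                     (trans (cong (y zero xor_) yo≡yx) differ)
    one-at-x : y (suc x) xor y (cycle x o ⟨$⟩ˡ suc x) ≡ true
    one-at-x = trans (cong (λ j → y (suc x) xor y j) (cycle⁻¹-a (≢-sym o≢x)))
                     (trans (xor-comm (y (suc x)) (y zero)) differ)
  ... | no  yo≢yx = G-≗ (EvenOn-pair₀ (≢-sym o≢x) (EvenOn-swap (EvenOn-coboundary o≢x y)) one-at-0 one-at-x)
                        (K-⊕ y∈K (K-act (G-lift o x) y∈K))
    where
    one-at-0 : y zero xor y (cycle o x ⟨$⟩ˡ zero) ≡ true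
    one-at-0 = trans (cong (λ j → y zero xor y j) (cycle⁻¹-0 o≢x)) differ
    one-at-x : y (suc x) xor y (cycle o x ⟨$⟩ˡ suc x) ≡ true
    one-at-x = trans (cong (λ j → y (suc x) xor y j) (cycle⁻¹-b o x)) (≢⇒xor≡true (≢-sym yo≢yx))

  nonconstant-at-0⇒K-full : ∀ {x y} → K y → y zero xor y (suc x) ≡ true → K-full
  nonconstant-at-0⇒K-full {x} y∈K differ o with o ≟ x
  ... | yes refl = pair₀∈K (other-≢ o) y∈K differ
  ... | no  o≢x  =
    pair₀∈K (≢-sym o≢x) (pair₀∈K (other-≢ x) y∈K differ) (cong (true xor_) (pair₀-other o≢x))

  nonconstant⇒K-full : ∀ {y} i j → K y → y (suc i) xor y (suc j) ≡ true → K-full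
  nonconstant⇒K-full {y} _ _ y∈K differ =
    [ nonconstant-at-0⇒K-full y∈K , nonconstant-at-0⇒K-full y∈K ]′ (xor-true-either (y zero) differ)

  vanishes-off₃⇒K-full : ∀ {y} a b c → K y → y (suc a) ≡ true →
                         (∀ {o} → o ≢ a → o ≢ b → o ≢ c → y (suc o) ≡ false) → K-full
  vanishes-off₃⇒K-full a b c y∈K y-at-a vanishes with fresh₃ a b c
  ... | o , o≢a , o≢b , o≢c = nonconstant⇒K-full a o y∈K (cong₂ _xor_ y-at-a (vanishes o≢a o≢b o≢c))

  u-at-a-varies⇒K-full : ∀ {a b c} → a ≢ b → a ≢ c → c ≢ b →
                         u a b (suc a) xor u a c (suc a) ≡ true → K-full
  u-at-a-varies⇒K-full {a} {b} {c} a≢b a≢c c≢b differ = vanishes-off₃⇒K-full a b c y∈K y-at-a y-elsewhere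
    where
    y∈K : K (u a b ⊕ (u c b ⊕ act (cycle c b) (u a c)))
    y∈K = lifts-differ (G-u a≢b) (closed· _ _ (G-u c≢b) (G-u a≢c)) (cycle-split a≢b a≢c c≢b)
    y-at-a : u a b (suc a) xor (u c b (suc a) xor u a c (cycle c b ⟨$⟩ˡ suc a)) ≡ true
    y-at-a = trans (cong₂ (λ p j → u a b (suc a) xor (p xor u a c j))
                          (outside (u-EvenOn c≢b) a≢c a≢b) (cycle⁻¹-fix a≢c a≢b))
                   differ
    y-elsewhere : ∀ {o} → o ≢ a → o ≢ b → o ≢ c →
                  u a b (suc o) xor (u c b (suc o) xor u a c (cycle c b ⟨$⟩ˡ suc o)) ≡ false
    y-elsewhere {o} o≢a o≢b o≢c =
      trans (cong (λ j → u a b (suc o) xor (u c b (suc o) xor u a c j)) (cycle⁻¹-fix o≢c o≢b))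
            (cong₂ _xor_ (outside (u-EvenOn a≢b) o≢a o≢b)
                         (cong₂ _xor_ (outside (u-EvenOn c≢b) o≢c o≢b) (outside (u-EvenOn a≢c) o≢a o≢c)))

  u-square-mismatch⇒K-full : ∀ {a b} → a ≢ b → u a b zero xor u b a (suc b) ≡ true → K-full
  u-square-mismatch⇒K-full {a} {b} a≢b differ = vanishes-off₃⇒K-full b a a y∈K y-at-b y-elsewhere
    where
    y∈K : K ((u a b ⊕ act (cycle a b) (u a b)) ⊕ u b a)
    y∈K = lifts-differ (closed· _ _ (G-u a≢b) (G-u a≢b)) (G-u (≢-sym a≢b)) (cycle-square a≢b)
    u-at-0 : u a b zero ≡ u a b (suc b) xor u a b (suc a)
    u-at-0 = trans (even-at-0 (u-EvenOn a≢b)) (xor-comm (u a b (suc a)) (u a b (suc b)))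
    y-at-b : (u a b (suc b) xor u a b (cycle a b ⟨$⟩ˡ suc b)) xor u b a (suc b) ≡ true
    y-at-b = trans (cong (λ j → (u a b (suc b) xor u a b j) xor u b a (suc b)) (cycle⁻¹-b a b))
                   (trans (cong (_xor u b a (suc b)) (sym u-at-0)) differ)
    y-elsewhere : ∀ {o} → o ≢ b → o ≢ a → o ≢ a →
                  (u a b (suc o) xor u a b (cycle a b ⟨$⟩ˡ suc o)) xor u b a (suc o) ≡ false
    y-elsewhere {o} o≢b o≢a _ =
      trans (cong (λ j → (u a b (suc o) xor u a b j) xor u b a (suc o)) (cycle⁻¹-fix o≢a o≢b))
            (cong₂ (λ p q → (p xor p) xor q) (outside (u-EvenOn a≢b) o≢a o≢b)
                                             (outside (u-EvenOn (≢-sym a≢b)) o≢b o≢a))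

  v : Vect (5 + n)
  v zero    = false
  v (suc a) = u a (other a) (suc a)

  v-mismatch-at-a⇒K-full : ∀ {a b} → a ≢ b → u a b (suc a) xor v (suc a) ≡ true → K-full
  v-mismatch-at-a⇒K-full {a} {b} a≢b differ = by-cases (other a ≟ b)
    where
    by-cases : Dec (other a ≡ b) → K-full
    by-cases (yes other≡b) = contradiction (trans (sym (xor-same (u a b (suc a)))) differ′) λ ()
      where
      differ′ : u a b (suc a) xor u a b (suc a) ≡ true
      differ′ = subst (λ t → u a b (suc a) xor u a t (suc a) ≡ true) other≡b differ
    by-cases (no  other≢b) = u-at-a-varies⇒K-full a≢b (≢-sym (other-≢ a)) other≢b differ

  v-mismatch-at-0⇒K-full : ∀ {a b} → a ≢ b → u a b zero xor v (suc b) ≡ true → K-full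
  v-mismatch-at-0⇒K-full {a} {b} a≢b differ = by-cases (u a b zero ≟ᵇ u b a (suc b))
    where
    by-cases : Dec (u a b zero ≡ u b a (suc b)) → K-full
    by-cases (yes same)      =
      v-mismatch-at-a⇒K-full (≢-sym a≢b) (subst (λ t → t xor v (suc b) ≡ true) same differ)
    by-cases (no  different) = u-square-mismatch⇒K-full a≢b (≢⇒xor≡true different)

  G-section-id : G (section v idₚ)
  G-section-id = G-≗ (λ i → sym (xor-same (v i))) hasId

  G-section-cycle : ∀ a b → G (section v (cycle a b))
  G-section-cycle a b with a ≟ b
  ... | yes refl = resp _ _ (section-cong v idₚ (cycle a a) (λ x → sym (cycle-self a x))) G-section-id
  ... | no  a≢b  = resp _ _ ((λ i → xor-cancelʳ (u a b i) _) , λ _ → refl) (closed· _ _ z∈K (G-u a≢b))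
    where
    z : Vect (5 + n)
    z = u a b ⊕ (v ⊕ act (cycle a b) v)
    z-even : EvenOn a b z
    z-even = EvenOn-⊕ (u-EvenOn a≢b) (EvenOn-coboundary a≢b v)
    z-at-a : z (suc a) ≡ u a b (suc a) xor v (suc a)
    z-at-a = trans (cong (λ j → u a b (suc a) xor (v (suc a) xor v j)) (cycle⁻¹-a a≢b))
                   (cong (u a b (suc a) xor_) (xor-identityʳ (v (suc a))))
    z-at-0 : z zero ≡ u a b zero xor v (suc b)
    z-at-0 = cong (λ j → u a b zero xor v j) (cycle⁻¹-0 a≢b)
    z∈K : K z
    z∈K = by-values (z (suc a)) (z zero) refl refl
      where
      by-values : ∀ p q → z (suc a) ≡ p → z zero ≡ q → K z
      by-values true  _     za _  =
        K-full⇒EvenOn⊆K (v-mismatch-at-a⇒K-full a≢b (trans (sym z-at-a) za)) a≢b z-even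
      by-values false true  _  z0 =
        K-full⇒EvenOn⊆K (v-mismatch-at-0⇒K-full a≢b (trans (sym z-at-0) z0)) a≢b z-even
      by-values false false za z0 = G-≗ (λ i → sym (EvenOn-vanishes a≢b z-even za z0 i)) hasId

  G-section-cycles : ∀ ps → G (section v (cycles ps))
  G-section-cycles []             = G-section-id
  G-section-cycles ((a , b) ∷ ps) =
    resp _ _ product (closed· _ _ (G-section-cycles ps) (G-section-cycle a b))
    where
    product : (section v (cycles ps) · section v (cycle a b)) ≈W section v (cycles ps ∘' cycle a b)
    product = ≈W-sym {x = section v (cycles ps ∘' cycle a b)}
                     {y = section v (cycles ps) · section v (cycle a b)}
                     (section-∘ v (cycles ps) (cycle a b))

  G-section : ∀ σ → IsEven σ → G (section v σ)
  G-section σ even =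
    resp _ _ (section-cong v (cycles (proj₁ by-cycles)) σ (λ x → sym (proj₂ by-cycles x)))
             (G-section-cycles (proj₁ by-cycles))
    where
    by-cycles : ∃ λ ps → σ ≈ₚ cycles ps
    by-cycles = even⇒cycles σ even

lemma7p2 : (d : ℕ) → 5 ≤ d → (G : W d → Set) → IsSubgroup G →
    ProjSurjective G → Splits G
lemma7p2 _ (s≤s (s≤s (s≤s (s≤s (s≤s (z≤n {n})))))) G G-subgroup π-surjective =
    section v
  , G-section
  , (λ σ τ _ _ → section-cong v σ τ)
  , (λ σ τ _ _ → section-∘ v σ τ)
  , (λ _ _ _ → refl)
  where
  open Splitting G G-subgroup π-surjective
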